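{- Let $n$ be a nonnegative integer. Suppose there exist a nonnegative integer $B$ and integers $x,y,z$ such that $$\frac{2n+10B}{3}-10B^2=2x^2+3y^2+4z^2+(2x+3y+4z)^2<(B+1)^2.$$ Then there exist nonnegative integers $w_0,x_0,y_0,z_0$ with $n=p_5(w_0)+2p_5(x_0)+3p_5(y_0)+4p_5(z_0)$, where $p_5(m)=m(3m-1)/2$.
   Context: The pentagonal numbers are $p_5(m)=m(3m-1)/2$ for $m\in\{0,1,2,\ldots\}$. -}

module Defs where

open import Data.Nat using (ℕ; _*_; _∸_; _/_)
open import Data.Integer as ℤ using (ℤ)

-- pentagonal numbers p₅(m) = m(3m-1)/2  (exact division; for m = 0 this is 0)
p5 : ℕ → ℕ
p5 m = (m * (3 * m ∸ 1)) / 2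

Q : ℤ → ℤ → ℤ → ℤ
Q x y z = ℤ.+ 2 ℤ.* (x ℤ.* x) ℤ.+ ℤ.+ 3 ℤ.* (y ℤ.* y) ℤ.+ ℤ.+ 4 ℤ.* (z ℤ.* z)
          ℤ.+ (s ℤ.* s)
  where
    s : ℤ
    s = ℤ.+ 2 ℤ.* x ℤ.+ ℤ.+ 3 ℤ.* y ℤ.+ ℤ.+ 4 ℤ.* z

{-# OPTIONS --safe #-}
module Submission where

-- Put s = 2x + 3y + 4z. Every term of Q is nonnegative, so x², y², z², s² ≤ Q < (B + 1)²,
-- and w₀ = B - s, x₀ = B + x, y₀ = B + y, z₀ = B + z are natural numbers. With the
-- weights 1, 2, 3, 4 the cross terms cancel: w₀ + 2x₀ + 3y₀ + 4z₀ = 10B and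
-- w₀² + 2x₀² + 3y₀² + 4z₀² = 10B² + Q. As 2p₅(m) = 3m² - m, twice the weighted sum
-- of the p₅ values is 3(10B² + Q) - 10B, which is 2n by hypothesis.

open import Defs
open import Data.Nat as ℕ using (ℕ; zero; suc)
open import Data.Integer as ℤ using (ℤ; +_; -[1+_]; ∣_∣)
open import Data.Product using (_×_; _,_; ∃-syntax)
open import Relation.Binary.PropositionalEquality using (_≡_; refl; sym; trans; cong; cong₂; subst; subst₂; module ≡-Reasoning)
open import Algebra.Bundles using (AbelianGroup)
open import Data.Nat.DivMod using (m*n/n≡m)
import Data.Nat.Properties as ℕ
import Data.Integer.Properties as ℤ
import Data.Nat.Tactic.RingSolver as ℕ-Solver
import Data.Integer.Tactic.RingSolver as ℤ-Solver
open import Algebra.Properties.Group (AbelianGroup.group ℤ.+-0-abelianGroup) using (∙-cancelʳ)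

-- p₅ through its recurrence p₅(m + 1) = p₅(m) + 3m + 1, which avoids the division in p5.
pent : ℕ → ℕ
pent zero    = 0
pent (suc m) = pent m ℕ.+ (3 ℕ.* m ℕ.+ 1)

2*pent+m≡3*m*m : ∀ m → 2 ℕ.* pent m ℕ.+ m ≡ 3 ℕ.* (m ℕ.* m)
2*pent+m≡3*m*m zero    = refl
2*pent+m≡3*m*m (suc m) = begin
  2 ℕ.* (pent m ℕ.+ (3 ℕ.* m ℕ.+ 1)) ℕ.+ suc m ≡⟨ regroup (pent m) m ⟩
  (2 ℕ.* pent m ℕ.+ m) ℕ.+ (6 ℕ.* m ℕ.+ 3)     ≡⟨ cong (ℕ._+ (6 ℕ.* m ℕ.+ 3)) (2*pent+m≡3*m*m m) ⟩
  3 ℕ.* (m ℕ.* m) ℕ.+ (6 ℕ.* m ℕ.+ 3)         ≡⟨ expand m ⟨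
  3 ℕ.* (suc m ℕ.* suc m)                      ∎
  where
  open ≡-Reasoning
  regroup : ∀ p m → 2 ℕ.* (p ℕ.+ (3 ℕ.* m ℕ.+ 1)) ℕ.+ suc m ≡ (2 ℕ.* p ℕ.+ m) ℕ.+ (6 ℕ.* m ℕ.+ 3)
  regroup = ℕ-Solver.solve-∀
  expand : ∀ m → 3 ℕ.* (suc m ℕ.* suc m) ≡ 3 ℕ.* (m ℕ.* m) ℕ.+ (6 ℕ.* m ℕ.+ 3)
  expand = ℕ-Solver.solve-∀

p5≡pent : ∀ m → p5 m ≡ pent m
p5≡pent m = trans (cong (ℕ._/ 2) numerator≡pent*2) (m*n/n≡m (pent m) 2)
  where
  open ≡-Reasoning
  numerator≡pent*2 : m ℕ.* (3 ℕ.* m ℕ.∸ 1) ≡ pent m ℕ.* 2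
  numerator≡pent*2 = begin
    m ℕ.* (3 ℕ.* m ℕ.∸ 1)           ≡⟨ ℕ.*-distribˡ-∸ m (3 ℕ.* m) 1 ⟩
    m ℕ.* (3 ℕ.* m) ℕ.∸ m ℕ.* 1     ≡⟨ cong₂ ℕ._∸_ (ℕ.*-comm m (3 ℕ.* m)) (ℕ.*-identityʳ m) ⟩
    3 ℕ.* m ℕ.* m ℕ.∸ m             ≡⟨ cong (ℕ._∸ m) (ℕ.*-assoc 3 m m) ⟩
    3 ℕ.* (m ℕ.* m) ℕ.∸ m           ≡⟨ cong (ℕ._∸ m) (2*pent+m≡3*m*m m) ⟨
    2 ℕ.* pent m ℕ.+ m ℕ.∸ m        ≡⟨ ℕ.m+n∸n≡m (2 ℕ.* pent m) m ⟩
    2 ℕ.* pent m                    ≡⟨ ℕ.*-comm 2 (pent m) ⟩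
    pent m ℕ.* 2                    ∎

2*p5+t≡3*t*t : ∀ m t → + m ≡ t → + 2 ℤ.* + p5 m ℤ.+ t ≡ + 3 ℤ.* (t ℤ.* t)
2*p5+t≡3*t*t m .(+ m) refl = begin
  + 2 ℤ.* + p5 m ℤ.+ + m      ≡⟨ cong (ℤ._+ + m) (ℤ.pos-* 2 (p5 m)) ⟨
  + (2 ℕ.* p5 m) ℤ.+ + m      ≡⟨ ℤ.pos-+ (2 ℕ.* p5 m) m ⟨
  + (2 ℕ.* p5 m ℕ.+ m)        ≡⟨ cong (λ k → + (2 ℕ.* k ℕ.+ m)) (p5≡pent m) ⟩
  + (2 ℕ.* pent m ℕ.+ m)      ≡⟨ cong +_ (2*pent+m≡3*m*m m) ⟩
  + (3 ℕ.* (m ℕ.* m))         ≡⟨ ℤ.pos-* 3 (m ℕ.* m) ⟩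
  + 3 ℤ.* + (m ℕ.* m)         ≡⟨ cong (+ 3 ℤ.*_) (ℤ.pos-* m m) ⟩
  + 3 ℤ.* (+ m ℤ.* + m)       ∎
  where open ≡-Reasoning

σ : ℤ → ℤ → ℤ → ℤ
σ x y z = + 2 ℤ.* x ℤ.+ + 3 ℤ.* y ℤ.+ + 4 ℤ.* z

weighted : ℕ → ℕ → ℕ → ℕ → ℕ
weighted a b c d = a ℕ.+ 2 ℕ.* b ℕ.+ 3 ℕ.* c ℕ.+ 4 ℕ.* d

weightedℤ : ℤ → ℤ → ℤ → ℤ → ℤ
weightedℤ a b c d = a ℤ.+ + 2 ℤ.* b ℤ.+ + 3 ℤ.* c ℤ.+ + 4 ℤ.* d

weightedℤ-cong : ∀ {a a′ b b′ c c′ d d′} → a ≡ a′ → b ≡ b′ → c ≡ c′ → d ≡ d′ →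
  weightedℤ a b c d ≡ weightedℤ a′ b′ c′ d′
weightedℤ-cong refl refl refl refl = refl

pos-weighted : ∀ a b c d → + weighted a b c d ≡ weightedℤ (+ a) (+ b) (+ c) (+ d)
pos-weighted a b c d = begin
  + (a ℕ.+ 2 ℕ.* b ℕ.+ 3 ℕ.* c ℕ.+ 4 ℕ.* d)
    ≡⟨ ℤ.pos-+ (a ℕ.+ 2 ℕ.* b ℕ.+ 3 ℕ.* c) (4 ℕ.* d) ⟩
  + (a ℕ.+ 2 ℕ.* b ℕ.+ 3 ℕ.* c) ℤ.+ + (4 ℕ.* d)
    ≡⟨ cong₂ ℤ._+_ (ℤ.pos-+ (a ℕ.+ 2 ℕ.* b) (3 ℕ.* c)) (ℤ.pos-* 4 d) ⟩
  + (a ℕ.+ 2 ℕ.* b) ℤ.+ + (3 ℕ.* c) ℤ.+ + 4 ℤ.* + d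
    ≡⟨ cong (ℤ._+ + 4 ℤ.* + d) (cong₂ ℤ._+_ (ℤ.pos-+ a (2 ℕ.* b)) (ℤ.pos-* 3 c)) ⟩
  + a ℤ.+ + (2 ℕ.* b) ℤ.+ + 3 ℤ.* + c ℤ.+ + 4 ℤ.* + d
    ≡⟨ cong (λ k → + a ℤ.+ k ℤ.+ + 3 ℤ.* + c ℤ.+ + 4 ℤ.* + d) (ℤ.pos-* 2 b) ⟩
  weightedℤ (+ a) (+ b) (+ c) (+ d) ∎
  where open ≡-Reasoning

weighted-bounds : ∀ a b c d → let N = weighted a b c d in
  a ℕ.≤ N × b ℕ.≤ N × c ℕ.≤ N × d ℕ.≤ N
weighted-bounds a b c d =
  ℕ.≤-trans (ℕ.m≤m+n a (2 ℕ.* b)) W₂≤W ,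
  ℕ.≤-trans (ℕ.m≤n*m b 2) (ℕ.≤-trans (ℕ.m≤n+m (2 ℕ.* b) a) W₂≤W) ,
  ℕ.≤-trans (ℕ.m≤n*m c 3) (ℕ.≤-trans (ℕ.m≤n+m (3 ℕ.* c) (a ℕ.+ 2 ℕ.* b)) W₃≤W) ,
  ℕ.≤-trans (ℕ.m≤n*m d 4) (ℕ.m≤n+m (4 ℕ.* d) (a ℕ.+ 2 ℕ.* b ℕ.+ 3 ℕ.* c))
  where
  W₃≤W : a ℕ.+ 2 ℕ.* b ℕ.+ 3 ℕ.* c ℕ.≤ weighted a b c d
  W₃≤W = ℕ.m≤m+n _ (4 ℕ.* d)
  W₂≤W : a ℕ.+ 2 ℕ.* b ℕ.≤ weighted a b c d
  W₂≤W = ℕ.≤-trans (ℕ.m≤m+n _ (3 ℕ.* c)) W₃≤W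

∣_∣² : ℤ → ℕ
∣ i ∣² = ∣ i ∣ ℕ.* ∣ i ∣

i*i≡+∣i∣² : ∀ i → i ℤ.* i ≡ + ∣ i ∣²
i*i≡+∣i∣² (+ k)    = sym (ℤ.pos-* k k)
i*i≡+∣i∣² -[1+ k ] = refl

Q≡weighted-squares : ∀ x y z → Q x y z ≡ + weighted ∣ σ x y z ∣² ∣ x ∣² ∣ y ∣² ∣ z ∣²
Q≡weighted-squares x y z = begin
  Q x y z                                          ≡⟨ Q-as-weighted x y z ⟩
  weightedℤ (s ℤ.* s) (x ℤ.* x) (y ℤ.* y) (z ℤ.* z) ≡⟨ weightedℤ-cong (i*i≡+∣i∣² s) (i*i≡+∣i∣² x) (i*i≡+∣i∣² y) (i*i≡+∣i∣² z) ⟩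
  weightedℤ (+ ∣ s ∣²) (+ ∣ x ∣²) (+ ∣ y ∣²) (+ ∣ z ∣²) ≡⟨ pos-weighted ∣ s ∣² ∣ x ∣² ∣ y ∣² ∣ z ∣² ⟨
  + weighted ∣ s ∣² ∣ x ∣² ∣ y ∣² ∣ z ∣²              ∎
  where
  open ≡-Reasoning
  s : ℤ
  s = σ x y z
  Q-as-weighted : ∀ x y z → let s = + 2 ℤ.* x ℤ.+ + 3 ℤ.* y ℤ.+ + 4 ℤ.* z in
    + 2 ℤ.* (x ℤ.* x) ℤ.+ + 3 ℤ.* (y ℤ.* y) ℤ.+ + 4 ℤ.* (z ℤ.* z) ℤ.+ s ℤ.* s
      ≡ s ℤ.* s ℤ.+ + 2 ℤ.* (x ℤ.* x) ℤ.+ + 3 ℤ.* (y ℤ.* y) ℤ.+ + 4 ℤ.* (z ℤ.* z)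
  Q-as-weighted = ℤ-Solver.solve-∀

square-bound : ∀ {u N} B → u ℕ.* u ℕ.≤ N → N ℕ.< suc B ℕ.* suc B → u ℕ.≤ B
square-bound B u²≤N N<[1+B]² =
  ℕ.≮⇒≥ λ B<u → ℕ.<⇒≱ N<[1+B]² (ℕ.≤-trans (ℕ.*-mono-≤ B<u B<u) u²≤N)

+B+1≡+[1+B] : ∀ B → + B ℤ.+ + 1 ≡ + suc B
+B+1≡+[1+B] B = trans (sym (ℤ.pos-+ B 1)) (cong +_ (ℕ.+-comm B 1))

coordinates-bounded : ∀ B x y z → Q x y z ℤ.< (+ B ℤ.+ + 1) ℤ.* (+ B ℤ.+ + 1) →
  ∣ σ x y z ∣ ℕ.≤ B × ∣ x ∣ ℕ.≤ B × ∣ y ∣ ℕ.≤ B × ∣ z ∣ ℕ.≤ B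
coordinates-bounded B x y z Q<[B+1]² =
  let (s²≤N , x²≤N , y²≤N , z²≤N) = weighted-bounds ∣ σ x y z ∣² ∣ x ∣² ∣ y ∣² ∣ z ∣²
  in bounded s²≤N , bounded x²≤N , bounded y²≤N , bounded z²≤N
  where
  N : ℕ
  N = weighted ∣ σ x y z ∣² ∣ x ∣² ∣ y ∣² ∣ z ∣²
  [B+1]²≡ : (+ B ℤ.+ + 1) ℤ.* (+ B ℤ.+ + 1) ≡ + (suc B ℕ.* suc B)
  [B+1]²≡ = trans (cong₂ ℤ._*_ (+B+1≡+[1+B] B) (+B+1≡+[1+B] B)) (sym (ℤ.pos-* (suc B) (suc B)))
  N<[1+B]² : N ℕ.< suc B ℕ.* suc B
  N<[1+B]² = ℤ.drop‿+<+ (subst₂ ℤ._<_ (Q≡weighted-squares x y z) [B+1]²≡ Q<[B+1]²)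
  bounded : ∀ {u} → u ℕ.* u ℕ.≤ N → u ℕ.≤ B
  bounded u²≤N = square-bound B u²≤N N<[1+B]²

∣i∣≤n⇒n+i≡+ : ∀ n i → ∣ i ∣ ℕ.≤ n → ∃[ m ] + m ≡ + n ℤ.+ i
∣i∣≤n⇒n+i≡+ n (+ k)    _      = n ℕ.+ k , ℤ.pos-+ n k
∣i∣≤n⇒n+i≡+ n -[1+ k ] 1+k≤n = n ℕ.∸ suc k , sym (ℤ.⊖-≥ 1+k≤n)

weightedℤ-linear : ∀ α β {p₁ p₂ p₃ p₄ t₁ t₂ t₃ t₄ u₁ u₂ u₃ u₄} →
  α ℤ.* p₁ ℤ.+ t₁ ≡ β ℤ.* u₁ → α ℤ.* p₂ ℤ.+ t₂ ≡ β ℤ.* u₂ →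
  α ℤ.* p₃ ℤ.+ t₃ ≡ β ℤ.* u₃ → α ℤ.* p₄ ℤ.+ t₄ ≡ β ℤ.* u₄ →
  α ℤ.* weightedℤ p₁ p₂ p₃ p₄ ℤ.+ weightedℤ t₁ t₂ t₃ t₄ ≡ β ℤ.* weightedℤ u₁ u₂ u₃ u₄
weightedℤ-linear α β {p₁} {p₂} {p₃} {p₄} {t₁} {t₂} {t₃} {t₄} {u₁} {u₂} {u₃} {u₄} e₁ e₂ e₃ e₄ = begin
  α ℤ.* weightedℤ p₁ p₂ p₃ p₄ ℤ.+ weightedℤ t₁ t₂ t₃ t₄
    ≡⟨ distribute α p₁ p₂ p₃ p₄ t₁ t₂ t₃ t₄ ⟩
  weightedℤ (α ℤ.* p₁ ℤ.+ t₁) (α ℤ.* p₂ ℤ.+ t₂) (α ℤ.* p₃ ℤ.+ t₃) (α ℤ.* p₄ ℤ.+ t₄)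
    ≡⟨ weightedℤ-cong e₁ e₂ e₃ e₄ ⟩
  weightedℤ (β ℤ.* u₁) (β ℤ.* u₂) (β ℤ.* u₃) (β ℤ.* u₄)
    ≡⟨ factor β u₁ u₂ u₃ u₄ ⟩
  β ℤ.* weightedℤ u₁ u₂ u₃ u₄ ∎
  where
  open ≡-Reasoning
  distribute : ∀ α p₁ p₂ p₃ p₄ t₁ t₂ t₃ t₄ →
    α ℤ.* (p₁ ℤ.+ + 2 ℤ.* p₂ ℤ.+ + 3 ℤ.* p₃ ℤ.+ + 4 ℤ.* p₄) ℤ.+ (t₁ ℤ.+ + 2 ℤ.* t₂ ℤ.+ + 3 ℤ.* t₃ ℤ.+ + 4 ℤ.* t₄)
      ≡ (α ℤ.* p₁ ℤ.+ t₁) ℤ.+ + 2 ℤ.* (α ℤ.* p₂ ℤ.+ t₂) ℤ.+ + 3 ℤ.* (α ℤ.* p₃ ℤ.+ t₃) ℤ.+ + 4 ℤ.* (α ℤ.* p₄ ℤ.+ t₄)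
  distribute = ℤ-Solver.solve-∀
  factor : ∀ β u₁ u₂ u₃ u₄ →
    β ℤ.* u₁ ℤ.+ + 2 ℤ.* (β ℤ.* u₂) ℤ.+ + 3 ℤ.* (β ℤ.* u₃) ℤ.+ + 4 ℤ.* (β ℤ.* u₄)
      ≡ β ℤ.* (u₁ ℤ.+ + 2 ℤ.* u₂ ℤ.+ + 3 ℤ.* u₃ ℤ.+ + 4 ℤ.* u₄)
  factor = ℤ-Solver.solve-∀

-- Ring identities are stated unfolded: the reflective solver does not unfold weightedℤ or Q.
shifted-weighted-sum : ∀ B x y z → let s = + 2 ℤ.* x ℤ.+ + 3 ℤ.* y ℤ.+ + 4 ℤ.* z in
  (B ℤ.- s) ℤ.+ + 2 ℤ.* (B ℤ.+ x) ℤ.+ + 3 ℤ.* (B ℤ.+ y) ℤ.+ + 4 ℤ.* (B ℤ.+ z) ≡ + 10 ℤ.* B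
shifted-weighted-sum = ℤ-Solver.solve-∀

shifted-weighted-squares : ∀ B x y z → let s = + 2 ℤ.* x ℤ.+ + 3 ℤ.* y ℤ.+ + 4 ℤ.* z in
  (B ℤ.- s) ℤ.* (B ℤ.- s) ℤ.+ + 2 ℤ.* ((B ℤ.+ x) ℤ.* (B ℤ.+ x))
    ℤ.+ + 3 ℤ.* ((B ℤ.+ y) ℤ.* (B ℤ.+ y)) ℤ.+ + 4 ℤ.* ((B ℤ.+ z) ℤ.* (B ℤ.+ z))
  ≡ + 10 ℤ.* (B ℤ.* B)
    ℤ.+ (+ 2 ℤ.* (x ℤ.* x) ℤ.+ + 3 ℤ.* (y ℤ.* y) ℤ.+ + 4 ℤ.* (z ℤ.* z) ℤ.+ s ℤ.* s)
shifted-weighted-squares = ℤ-Solver.solve-∀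

pentagonal-representation : ∀ n B x y z w₀ x₀ y₀ z₀ →
  + w₀ ≡ + B ℤ.- σ x y z → + x₀ ≡ + B ℤ.+ x → + y₀ ≡ + B ℤ.+ y → + z₀ ≡ + B ℤ.+ z →
  + 2 ℤ.* + n ℤ.+ + 10 ℤ.* + B ≡ + 3 ℤ.* (+ 10 ℤ.* (+ B ℤ.* + B) ℤ.+ Q x y z) →
  n ≡ weighted (p5 w₀) (p5 x₀) (p5 y₀) (p5 z₀)
pentagonal-representation n B x y z w₀ x₀ y₀ z₀ w₀≡ x₀≡ y₀≡ z₀≡ 2n+10B≡ =
  ℤ.+-injective (begin
    + n ≡⟨ ℤ.*-cancelˡ-≡ (+ 2) P (+ n) (∙-cancelʳ (+ 10 ℤ.* + B) (+ 2 ℤ.* P) (+ 2 ℤ.* + n) 2P+10B≡2n+10B) ⟨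
    P   ≡⟨ pos-weighted (p5 w₀) (p5 x₀) (p5 y₀) (p5 z₀) ⟨
    + weighted (p5 w₀) (p5 x₀) (p5 y₀) (p5 z₀) ∎)
  where
  open ≡-Reasoning
  P : ℤ
  P = weightedℤ (+ p5 w₀) (+ p5 x₀) (+ p5 y₀) (+ p5 z₀)
  2P+10B≡2n+10B : + 2 ℤ.* P ℤ.+ + 10 ℤ.* + B ≡ + 2 ℤ.* + n ℤ.+ + 10 ℤ.* + B
  2P+10B≡2n+10B = begin
    + 2 ℤ.* P ℤ.+ + 10 ℤ.* + B
      ≡⟨ cong (ℤ._+_ (+ 2 ℤ.* P)) (shifted-weighted-sum (+ B) x y z) ⟨
    + 2 ℤ.* P ℤ.+ weightedℤ (+ B ℤ.- σ x y z) (+ B ℤ.+ x) (+ B ℤ.+ y) (+ B ℤ.+ z)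
      ≡⟨ weightedℤ-linear (+ 2) (+ 3) {+ p5 w₀} {+ p5 x₀} {+ p5 y₀} {+ p5 z₀}
           (2*p5+t≡3*t*t w₀ _ w₀≡) (2*p5+t≡3*t*t x₀ _ x₀≡)
           (2*p5+t≡3*t*t y₀ _ y₀≡) (2*p5+t≡3*t*t z₀ _ z₀≡) ⟩
    + 3 ℤ.* weightedℤ ((+ B ℤ.- σ x y z) ℤ.* (+ B ℤ.- σ x y z)) ((+ B ℤ.+ x) ℤ.* (+ B ℤ.+ x))
                      ((+ B ℤ.+ y) ℤ.* (+ B ℤ.+ y)) ((+ B ℤ.+ z) ℤ.* (+ B ℤ.+ z))
      ≡⟨ cong (+ 3 ℤ.*_) (shifted-weighted-squares (+ B) x y z) ⟩
    + 3 ℤ.* (+ 10 ℤ.* (+ B ℤ.* + B) ℤ.+ Q x y z)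
      ≡⟨ 2n+10B≡ ⟨
    + 2 ℤ.* + n ℤ.+ + 10 ℤ.* + B ∎

lemma3p2 : (n B : ℕ) (x y z : ℤ) →
    + 2 ℤ.* + n ℤ.+ + 10 ℤ.* + B ≡ + 3 ℤ.* (+ 10 ℤ.* (+ B ℤ.* + B) ℤ.+ Q x y z) →
    Q x y z ℤ.< (+ B ℤ.+ + 1) ℤ.* (+ B ℤ.+ + 1) →
    ∃[ w₀ ] ∃[ x₀ ] ∃[ y₀ ] ∃[ z₀ ]
      (n ≡ p5 w₀ ℕ.+ 2 ℕ.* p5 x₀ ℕ.+ 3 ℕ.* p5 y₀ ℕ.+ 4 ℕ.* p5 z₀)
lemma3p2 n B x y z 2n+10B≡ Q<[B+1]² =
  let (∣s∣≤B , ∣x∣≤B , ∣y∣≤B , ∣z∣≤B) = coordinates-bounded B x y z Q<[B+1]²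
      (w₀ , w₀≡) = ∣i∣≤n⇒n+i≡+ B (ℤ.- σ x y z) (subst (ℕ._≤ B) (sym (ℤ.∣-i∣≡∣i∣ (σ x y z))) ∣s∣≤B)
      (x₀ , x₀≡) = ∣i∣≤n⇒n+i≡+ B x ∣x∣≤B
      (y₀ , y₀≡) = ∣i∣≤n⇒n+i≡+ B y ∣y∣≤B
      (z₀ , z₀≡) = ∣i∣≤n⇒n+i≡+ B z ∣z∣≤B
  in w₀ , x₀ , y₀ , z₀ , pentagonal-representation n B x y z w₀ x₀ y₀ z₀ w₀≡ x₀≡ y₀≡ z₀≡ 2n+10B≡
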